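{- Let $k\ge 2$ and $j<k$ be positive integers, let $p_k(X)=X^k-2(X^{k-2}+X^{k-3}+\cdots+X+1)$, and let $F$ be a Boolean polynomial in the variables $X_1,\dots,X_j$ only. For $n\ge k$ let $\tau_{n,k}=\sum_{i=1}^{n-k+1}X_iX_{i+1}\cdots X_{i+k-1}$. Then both sequences (indexed by $n$) $$\{S(\tau_{n,k}+F)\}\quad\text{and}\quad\{S(\tau_{n,k}+F+X_n+X_nX_{n-1}+X_nX_{n-1}X_{n-2}+\cdots+X_nX_{n-1}\cdots X_{n-k+2})\}$$ satisfy the homogeneous linear recurrence whose characteristic polynomial is $p_k(X)$.
   Context: Boolean functions in $n$ variables are maps $\mathbb{F}_2^n\to\mathbb{F}_2$ written as polynomials in $X_1,\dots,X_n$; for a Boolean function $G$ in $X_1,\dots,X_n$, $S(G)=\sum_{\mathbf{x}\in\mathbb{F}_2^n}(-1)^{G(\mathbf{x})}$. A sequence satisfies the homogeneous linear recurrence with characteristic polynomial $X^d-\sum_{i=1}^d c_iX^{d-i}$ if $a_n=\sum_{i=1}^d c_ia_{n-i}$ for all admissible $n$. -}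

module Defs where

open import Data.Bool using (Bool; true; false; _xor_; _∧_; if_then_else_)
open import Data.Nat using (ℕ; zero; suc; _∸_; _≤_; _<_; _≡ᵇ_; _<ᵇ_)
open import Data.Integer using (ℤ; +_; -_; -[1+_]) renaming (_+_ to _+ℤ_; _*_ to _*ℤ_)
open import Data.List using (List; []; _∷_; map; _++_; foldr)
open import Data.Vec using (Vec; []; _∷_; tabulate)
open import Data.Fin using (Fin; toℕ)

allPoints : (n : ℕ) → List (Vec Bool n)
allPoints zero    = [] ∷ []
allPoints (suc n) = map (false ∷_) (allPoints n) ++ map (true ∷_) (allPoints n)

BoolFun : ℕ → Set
BoolFun n = Vec Bool n → Bool

sign : Bool → ℤ
sign false = + 1
sign true  = - (+ 1)

S : {n : ℕ} → BoolFun n → ℤ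
S {n} G = foldr (λ x acc → sign (G x) +ℤ acc) (+ 0) (allPoints n)

-- the variable Xᵢ (1-based index i); value false if i is out of range
X : {n : ℕ} → ℕ → Vec Bool n → Bool
X i []       = false
X zero (b ∷ v) = false
X (suc zero) (b ∷ v) = b
X (suc (suc i)) (b ∷ v) = X (suc i) v

⊕[_,+_] : ℕ → ℕ → (ℕ → Bool) → Bool
⊕[ a ,+ zero ] f = false
⊕[ a ,+ suc m ] f = f a xor ⊕[ suc a ,+ m ] f

⊗[_,+_] : ℕ → ℕ → (ℕ → Bool) → Bool
⊗[ a ,+ zero ] f = true
⊗[ a ,+ suc m ] f = f a ∧ ⊗[ suc a ,+ m ] f

τ : (n k : ℕ) → BoolFun n
τ n k x = ⊕[ 1 ,+ (suc n ∸ k) ] (λ i → ⊗[ i ,+ k ] (λ t → X t x))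

tail-sum : (n k : ℕ) → BoolFun n
tail-sum n k x = ⊕[ 1 ,+ (k ∸ 1) ] (λ m → ⊗[ 0 ,+ m ] (λ t → X (n ∸ t) x))

lift : {n : ℕ} (j : ℕ) → BoolFun j → BoolFun n
lift j F x = F (tabulate (λ (i : Fin j) → X (suc (toℕ i)) x))

_⊕_ : {n : ℕ} → BoolFun n → BoolFun n → BoolFun n
(f ⊕ g) x = f x xor g x

-- a monic polynomial X^d + Σ_{m<d} coeff m · X^m, given by its degree
-- and its coefficient function
record MonicPoly : Set where
  field
    deg   : ℕ
    coeff : ℕ → ℤ     -- coefficient of X^m (only m < deg is used)

p : ℕ → MonicPoly
p k = record { deg = k ; coeff = c }
  where
    c : ℕ → ℤ
    c m = if suc m <ᵇ k then - (+ 2) else + 0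

Σ₁ : ℕ → (ℕ → ℤ) → ℤ
Σ₁ zero f = + 0
Σ₁ (suc d) f = Σ₁ d f +ℤ f (suc d)

SatisfiesRecurrence : MonicPoly → (n₀ : ℕ) → (ℕ → ℤ) → Set
SatisfiesRecurrence P n₀ a =
  ∀ n → n₀ Data.Nat.+ d ≤ n →
    a n ≡ Σ₁ d (λ i → (- coeff (d ∸ i)) *ℤ a (n ∸ i))
  where
    open MonicPoly P renaming (deg to d)
    open import Relation.Binary.PropositionalEquality using (_≡_)

-- Write k = d + 1, Gₙ = τ_{n,k} + F, aₙ = S(Gₙ), bₙ = S(Gₙ + tail-sum n k) and
-- W(n,s,c) = S(Gₙ + Σ_{s ≤ u < s+c} XₙXₙ₋₁⋯Xₙ₋ᵤ₊₁) (partialS).  Appending x = Xₙ₊₁ adds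
-- x·XₙXₙ₋₁⋯Xₙ₋d₊₁ to Gₙ and multiplies every suffix monomial by x, so splitting
-- S over x = 0, 1 gives W(n+1, s+1, c) = aₙ + W(n, s, c+1) whenever s + c = d.
-- For s = 0 the empty monomial 1 flips the sign: b_{n+1} = aₙ − bₙ.  Iterating
-- from W(n, d+1, 0) = aₙ down to W(n−d, 1, d) = b_{n−d} gives
-- aₙ = a_{n−1} + ⋯ + a_{n−d} + b_{n−d}.  Eliminating a yields
-- b_{n+1} = 2(b_{n−1} + ⋯ + b_{n−d}), the recurrence of p_k, and it passes to
-- aₙ = b_{n+1} + bₙ.

module Submission where

open import Defs
open import Data.Bool using (Bool; true; false; not; _xor_; _∧_)
open import Data.Bool.Properties
  using (xor-assoc; xor-comm; xor-identityʳ; ∧-assoc; ∧-comm; ∧-identityʳ; ∧-zeroʳ; ∧-distribˡ-xor; not-distribʳ-xor)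
open import Data.Fin using (toℕ)
open import Data.Fin.Properties using (toℕ<n)
open import Data.Integer using (ℤ; +_; -_; _+_; _-_; _*_)
import Data.Integer.Properties as ℤ
open import Data.Integer.Tactic.RingSolver using (solve-∀)
open import Data.List using (List; []; _∷_; map; _++_; foldr)
open import Data.List.Properties using (foldr-cong; foldr-fusion; foldr-map)
open import Data.Nat using (ℕ; zero; suc; _∸_; _≤_; _<_; _<ᵇ_; z≤n; s≤s)
  renaming (_+_ to _+ℕ_)
import Data.Nat.Properties as ℕ
open import Data.Product using (_×_; _,_)
open import Data.Vec using (Vec; []; _∷_; _∷ʳ_)
open import Data.Vec.Properties using (tabulate-cong)
open import Function using (_∘_)
open import Relation.Binary.PropositionalEquality
open ≡-Reasoning

module _ {A : Set} where

  sumOver : (A → ℤ) → List A → ℤ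
  sumOver h = foldr (λ x acc → h x + acc) (+ 0)

  sumOver-++ : ∀ h (xs ys : List A) → sumOver h (xs ++ ys) ≡ sumOver h xs + sumOver h ys
  sumOver-++ h []       ys = sym (ℤ.+-identityˡ _)
  sumOver-++ h (x ∷ xs) ys = begin
    h x + sumOver h (xs ++ ys)         ≡⟨ cong (_+_ (h x)) (sumOver-++ h xs ys) ⟩
    h x + (sumOver h xs + sumOver h ys) ≡⟨ ℤ.+-assoc (h x) _ _ ⟨
    (h x + sumOver h xs) + sumOver h ys ∎

S-cong : ∀ {n} {G H : BoolFun n} → (∀ x → G x ≡ H x) → S G ≡ S H
S-cong {n} G≗H = foldr-cong (λ x acc → cong (λ b → sign b + acc) (G≗H x)) refl (allPoints n)

sign-not : ∀ b → sign (not b) ≡ - sign b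
sign-not true  = refl
sign-not false = refl

S-not : ∀ {n} (G : BoolFun n) → S (not ∘ G) ≡ - S G
S-not {n} G = begin
  S (not ∘ G)                   ≡⟨ foldr-cong (λ x acc → cong (_+ acc) (sign-not (G x))) refl (allPoints n) ⟩
  sumOver (λ x → - sign (G x)) (allPoints n)
    ≡⟨ foldr-fusion -_ {g = λ x acc → - sign (G x) + acc} (+ 0) (λ x acc → ℤ.neg-distrib-+ (sign (G x)) acc) (allPoints n) ⟨
  - S G                         ∎

S-∷ : ∀ {n} (G : BoolFun (suc n)) → S G ≡ S (G ∘ (false ∷_)) + S (G ∘ (true ∷_))
S-∷ {n} G = begin
  S G ≡⟨ sumOver-++ (sign ∘ G) (map (false ∷_) (allPoints n)) _ ⟩
  sumOver (sign ∘ G) (map (false ∷_) (allPoints n)) + sumOver (sign ∘ G) (map (true ∷_) (allPoints n))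
    ≡⟨ cong₂ _+_ (foldr-map _ (false ∷_) (+ 0) (allPoints n)) (foldr-map _ (true ∷_) (+ 0) (allPoints n)) ⟩
  S (G ∘ (false ∷_)) + S (G ∘ (true ∷_)) ∎

S-∷ʳ : ∀ n (G : BoolFun (suc n)) → S G ≡ S (G ∘ (_∷ʳ false)) + S (G ∘ (_∷ʳ true))
S-∷ʳ zero    G = S-∷ G
S-∷ʳ (suc n) G = begin
  S G                                   ≡⟨ S-∷ G ⟩
  S (G ∘ (false ∷_)) + S (G ∘ (true ∷_)) ≡⟨ cong₂ _+_ (S-∷ʳ n (G ∘ (false ∷_))) (S-∷ʳ n (G ∘ (true ∷_))) ⟩
  (S (G ∘ (false ∷_) ∘ (_∷ʳ false)) + S (G ∘ (false ∷_) ∘ (_∷ʳ true)))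
    + (S (G ∘ (true ∷_) ∘ (_∷ʳ false)) + S (G ∘ (true ∷_) ∘ (_∷ʳ true)))
    ≡⟨ interchange (S (G ∘ (false ∷_) ∘ (_∷ʳ false))) (S (G ∘ (false ∷_) ∘ (_∷ʳ true))) (S (G ∘ (true ∷_) ∘ (_∷ʳ false))) (S (G ∘ (true ∷_) ∘ (_∷ʳ true))) ⟩
  (S (G ∘ (false ∷_) ∘ (_∷ʳ false)) + S (G ∘ (true ∷_) ∘ (_∷ʳ false)))
    + (S (G ∘ (false ∷_) ∘ (_∷ʳ true)) + S (G ∘ (true ∷_) ∘ (_∷ʳ true)))
    ≡⟨ cong₂ _+_ (S-∷ (G ∘ (_∷ʳ false))) (S-∷ (G ∘ (_∷ʳ true))) ⟨
  S (G ∘ (_∷ʳ false)) + S (G ∘ (_∷ʳ true)) ∎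
  where
  interchange : ∀ w x y z → (w + x) + (y + z) ≡ (w + y) + (x + z)
  interchange = solve-∀

S-extend : ∀ {n} {G : BoolFun (suc n)} (H K : BoolFun n) →
           (∀ w x → G (w ∷ʳ x) ≡ H w xor (x ∧ K w)) → S G ≡ S H + S (H ⊕ K)
S-extend {n} {G} H K G-∷ʳ = trans (S-∷ʳ n G)
  (cong₂ _+_ (S-cong (λ w → trans (G-∷ʳ w false) (xor-identityʳ (H w)))) (S-cong (λ w → G-∷ʳ w true)))

⊕-shift : ∀ a c f → ⊕[ suc a ,+ c ] f ≡ ⊕[ a ,+ c ] (f ∘ suc)
⊕-shift a zero    f = refl
⊕-shift a (suc c) f = cong (f (suc a) xor_) (⊕-shift (suc a) c f)

⊗-shift : ∀ a c f → ⊗[ suc a ,+ c ] f ≡ ⊗[ a ,+ c ] (f ∘ suc)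
⊗-shift a zero    f = refl
⊗-shift a (suc c) f = cong (f (suc a) ∧_) (⊗-shift (suc a) c f)

⊕-cong : ∀ a c {f g} → (∀ i → i < a +ℕ c → f i ≡ g i) → ⊕[ a ,+ c ] f ≡ ⊕[ a ,+ c ] g
⊕-cong a zero    f≗g = refl
⊕-cong a (suc c) f≗g = cong₂ _xor_ (f≗g a (ℕ.m<m+n a (s≤s z≤n)))
  (⊕-cong (suc a) c (λ i i< → f≗g i (subst (i <_) (sym (ℕ.+-suc a c)) i<)))

⊗-cong : ∀ a c {f g} → (∀ i → i < a +ℕ c → f i ≡ g i) → ⊗[ a ,+ c ] f ≡ ⊗[ a ,+ c ] g
⊗-cong a zero    f≗g = refl
⊗-cong a (suc c) f≗g = cong₂ _∧_ (f≗g a (ℕ.m<m+n a (s≤s z≤n)))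
  (⊗-cong (suc a) c (λ i i< → f≗g i (subst (i <_) (sym (ℕ.+-suc a c)) i<)))

⊕-∷ʳ : ∀ a c f → ⊕[ a ,+ suc c ] f ≡ ⊕[ a ,+ c ] f xor f (a +ℕ c)
⊕-∷ʳ a zero    f = trans (xor-identityʳ (f a)) (cong f (sym (ℕ.+-identityʳ a)))
⊕-∷ʳ a (suc c) f = begin
  f a xor ⊕[ suc a ,+ suc c ] f                   ≡⟨ cong (f a xor_) (⊕-∷ʳ (suc a) c f) ⟩
  f a xor (⊕[ suc a ,+ c ] f xor f (suc a +ℕ c))   ≡⟨ xor-assoc (f a) _ _ ⟨
  ⊕[ a ,+ suc c ] f xor f (suc a +ℕ c)            ≡⟨ cong (λ m → ⊕[ a ,+ suc c ] f xor f m) (ℕ.+-suc a c) ⟨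
  ⊕[ a ,+ suc c ] f xor f (a +ℕ suc c)            ∎

⊗-∷ʳ : ∀ a c f → ⊗[ a ,+ suc c ] f ≡ ⊗[ a ,+ c ] f ∧ f (a +ℕ c)
⊗-∷ʳ a zero    f = trans (∧-identityʳ (f a)) (cong f (sym (ℕ.+-identityʳ a)))
⊗-∷ʳ a (suc c) f = begin
  f a ∧ ⊗[ suc a ,+ suc c ] f                  ≡⟨ cong (f a ∧_) (⊗-∷ʳ (suc a) c f) ⟩
  f a ∧ (⊗[ suc a ,+ c ] f ∧ f (suc a +ℕ c))    ≡⟨ ∧-assoc (f a) _ _ ⟨
  ⊗[ a ,+ suc c ] f ∧ f (suc a +ℕ c)           ≡⟨ cong (λ m → ⊗[ a ,+ suc c ] f ∧ f m) (ℕ.+-suc a c) ⟨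
  ⊗[ a ,+ suc c ] f ∧ f (a +ℕ suc c)           ∎

⊗-reverse : ∀ a c g → ⊗[ a ,+ c ] g ≡ ⊗[ 0 ,+ c ] (λ t → g (a +ℕ c ∸ suc t))
⊗-reverse a zero    g = refl
⊗-reverse a (suc c) g = begin
  ⊗[ a ,+ suc c ] g                                        ≡⟨ ⊗-∷ʳ a c g ⟩
  ⊗[ a ,+ c ] g ∧ g (a +ℕ c)                               ≡⟨ cong (_∧ g (a +ℕ c)) (⊗-reverse a c g) ⟩
  ⊗[ 0 ,+ c ] (λ t → g (a +ℕ c ∸ suc t)) ∧ g (a +ℕ c)       ≡⟨ ∧-comm _ (g (a +ℕ c)) ⟩
  g (a +ℕ c) ∧ ⊗[ 0 ,+ c ] (λ t → g (a +ℕ c ∸ suc t))       ≡⟨ cong (λ m → g (m ∸ 1) ∧ ⊗[ 0 ,+ c ] (λ t → g (m ∸ suc (suc t)))) (ℕ.+-suc a c) ⟨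
  g (a +ℕ suc c ∸ 1) ∧ ⊗[ 0 ,+ c ] (λ t → g (a +ℕ suc c ∸ suc (suc t)))
                                                           ≡⟨ cong (g (a +ℕ suc c ∸ 1) ∧_) (⊗-shift 0 c (λ t → g (a +ℕ suc c ∸ suc t))) ⟨
  ⊗[ 0 ,+ suc c ] (λ t → g (a +ℕ suc c ∸ suc t))            ∎

⊕-∧ˡ : ∀ x a c f → ⊕[ a ,+ c ] (λ i → x ∧ f i) ≡ x ∧ ⊕[ a ,+ c ] f
⊕-∧ˡ x a zero    f = sym (∧-zeroʳ x)
⊕-∧ˡ x a (suc c) f = trans (cong ((x ∧ f a) xor_) (⊕-∧ˡ x (suc a) c f)) (sym (∧-distribˡ-xor x _ _))

X-∷ʳ-≤ : ∀ {n} (w : Vec Bool n) x i → i ≤ n → X i (w ∷ʳ x) ≡ X i w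
X-∷ʳ-≤ []      x zero          _         = refl
X-∷ʳ-≤ (b ∷ w) x zero          _         = refl
X-∷ʳ-≤ (b ∷ w) x (suc zero)    _         = refl
X-∷ʳ-≤ (b ∷ w) x (suc (suc i)) (s≤s i≤n) = X-∷ʳ-≤ w x (suc i) i≤n

X-∷ʳ-last : ∀ {n} (w : Vec Bool n) x → X (suc n) (w ∷ʳ x) ≡ x
X-∷ʳ-last []      x = refl
X-∷ʳ-last (b ∷ w) x = X-∷ʳ-last w x

lift-∷ʳ : ∀ {n} j (F : BoolFun j) → j ≤ n → ∀ (w : Vec Bool n) x → lift j F (w ∷ʳ x) ≡ lift j F w
lift-∷ʳ j F j≤n w x = cong F (tabulate-cong (λ i → X-∷ʳ-≤ w x (suc (toℕ i)) (ℕ.≤-trans (toℕ<n i) j≤n)))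

-- XₙXₙ₋₁⋯Xₙ₋ᵤ₊₁ (1 for u = 0); tail-sum n k is suffixSum 1 (k ∸ 1) by definition.
suffixMonomial : {n : ℕ} → ℕ → BoolFun n
suffixMonomial {n} u w = ⊗[ 0 ,+ u ] (λ t → X (n ∸ t) w)

suffixSum : {n : ℕ} → ℕ → ℕ → BoolFun n
suffixSum s c w = ⊕[ s ,+ c ] (λ u → suffixMonomial u w)

suffixMonomial-∷ʳ : ∀ {n} (w : Vec Bool n) x u → suffixMonomial (suc u) (w ∷ʳ x) ≡ x ∧ suffixMonomial u w
suffixMonomial-∷ʳ {n} w x u = cong₂ _∧_ (X-∷ʳ-last w x) (begin
  ⊗[ 1 ,+ u ] (λ t → X (suc n ∸ t) (w ∷ʳ x)) ≡⟨ ⊗-shift 0 u _ ⟩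
  ⊗[ 0 ,+ u ] (λ t → X (n ∸ t) (w ∷ʳ x))     ≡⟨ ⊗-cong 0 u (λ t _ → X-∷ʳ-≤ w x (n ∸ t) (ℕ.m∸n≤m n t)) ⟩
  suffixMonomial u w                          ∎)

suffixSum-∷ʳ : ∀ {n} (w : Vec Bool n) x s c → suffixSum (suc s) c (w ∷ʳ x) ≡ x ∧ suffixSum s c w
suffixSum-∷ʳ w x s c = begin
  suffixSum (suc s) c (w ∷ʳ x)                           ≡⟨ ⊕-shift s c _ ⟩
  ⊕[ s ,+ c ] (λ u → suffixMonomial (suc u) (w ∷ʳ x))    ≡⟨ ⊕-cong s c (λ u _ → suffixMonomial-∷ʳ w x u) ⟩
  ⊕[ s ,+ c ] (λ u → x ∧ suffixMonomial u w)             ≡⟨ ⊕-∧ˡ x s c _ ⟩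
  x ∧ suffixSum s c w                                    ∎

τ-∷ʳ : ∀ {n} d → d ≤ n → ∀ (w : Vec Bool n) x →
       τ (suc n) (suc d) (w ∷ʳ x) ≡ τ n (suc d) w xor (x ∧ suffixMonomial d w)
τ-∷ʳ {n} d d≤n w x = begin
  ⊕[ 1 ,+ (suc n ∸ d) ] window          ≡⟨ cong (λ m → ⊕[ 1 ,+ m ] window) (ℕ.+-∸-assoc 1 d≤n) ⟩
  ⊕[ 1 ,+ suc c ] window               ≡⟨ ⊕-∷ʳ 1 c window ⟩
  ⊕[ 1 ,+ c ] window xor window (suc c) ≡⟨ cong₂ _xor_ old-windows last-window ⟩
  τ n (suc d) w xor (x ∧ suffixMonomial d w) ∎
  where
  c = n ∸ d
  c+d≡n : c +ℕ d ≡ n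
  c+d≡n = ℕ.m∸n+n≡m d≤n
  window : ℕ → Bool
  window i = ⊗[ i ,+ suc d ] (λ t → X t (w ∷ʳ x))
  inside : ∀ i t → i < suc c → t < i +ℕ suc d → t ≤ n
  inside i t (s≤s i≤c) t< = ℕ.≤-pred (ℕ.≤-trans t< (ℕ.≤-trans (ℕ.+-monoˡ-≤ (suc d) i≤c)
    (ℕ.≤-reflexive (trans (ℕ.+-suc c d) (cong suc c+d≡n)))))
  old-windows : ⊕[ 1 ,+ c ] window ≡ τ n (suc d) w
  old-windows = ⊕-cong 1 c (λ i i< → ⊗-cong i (suc d) (λ t t< → X-∷ʳ-≤ w x t (inside i t i< t<)))
  last-window : window (suc c) ≡ x ∧ suffixMonomial d w
  last-window = begin
    window (suc c)                                            ≡⟨ ⊗-reverse (suc c) (suc d) _ ⟩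
    ⊗[ 0 ,+ suc d ] (λ t → X (c +ℕ suc d ∸ t) (w ∷ʳ x))        ≡⟨ cong (λ m → ⊗[ 0 ,+ suc d ] (λ t → X (m ∸ t) (w ∷ʳ x)))
                                                                    (trans (ℕ.+-suc c d) (cong suc c+d≡n)) ⟩
    suffixMonomial (suc d) (w ∷ʳ x)                           ≡⟨ suffixMonomial-∷ʳ w x d ⟩
    x ∧ suffixMonomial d w                                    ∎

Σ₁-peel : ∀ d (f : ℕ → ℤ) → Σ₁ (suc d) f ≡ f 1 + Σ₁ d (f ∘ suc)
Σ₁-peel zero    f = trans (ℤ.+-identityˡ (f 1)) (sym (ℤ.+-identityʳ (f 1)))
Σ₁-peel (suc d) f = trans (cong (_+ f (suc (suc d))) (Σ₁-peel d f)) (ℤ.+-assoc (f 1) _ _)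

Σ₁-cong : ∀ d {f g} → (∀ i → 1 ≤ i → i ≤ d → f i ≡ g i) → Σ₁ d f ≡ Σ₁ d g
Σ₁-cong zero    f≗g = refl
Σ₁-cong (suc d) f≗g = cong₂ _+_ (Σ₁-cong d (λ i 1≤i i≤d → f≗g i 1≤i (ℕ.m≤n⇒m≤1+n i≤d))) (f≗g (suc d) (s≤s z≤n) ℕ.≤-refl)

Σ₁-+ : ∀ d (f g : ℕ → ℤ) → Σ₁ d (λ i → f i + g i) ≡ Σ₁ d f + Σ₁ d g
Σ₁-+ zero    f g = refl
Σ₁-+ (suc d) f g = trans (cong (_+ (f (suc d) + g (suc d))) (Σ₁-+ d f g)) (interchange (Σ₁ d f) (Σ₁ d g) (f (suc d)) (g (suc d)))
  where
  interchange : ∀ w x y z → (w + x) + (y + z) ≡ (w + y) + (x + z)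
  interchange = solve-∀

Σ₁-*ˡ : ∀ d c (f : ℕ → ℤ) → Σ₁ d (λ i → c * f i) ≡ c * Σ₁ d f
Σ₁-*ˡ zero    c f = sym (ℤ.*-zeroʳ c)
Σ₁-*ˡ (suc d) c f = trans (cong (_+ c * f (suc d)) (Σ₁-*ˡ d c f)) (sym (ℤ.*-distribˡ-+ c _ _))

-- No side condition d ≤ n is needed: suc n ∸ suc t reduces to n ∸ t.
Σ₁-telescope : ∀ d n (f : ℕ → ℤ) → Σ₁ d (λ t → f (suc n ∸ t)) + f (n ∸ d) ≡ f n + Σ₁ d (λ t → f (n ∸ t))
Σ₁-telescope zero    n f = trans (ℤ.+-identityˡ (f n)) (sym (ℤ.+-identityʳ (f n)))
Σ₁-telescope (suc d) n f = trans (cong (_+ f (n ∸ suc d)) (Σ₁-telescope d n f)) (ℤ.+-assoc (f n) _ _)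

module Splitting (d j : ℕ) (j≤d : j ≤ d) (F : BoolFun j) where

  G : (n : ℕ) → BoolFun n
  G n = τ n (suc d) ⊕ lift j F

  a b : ℕ → ℤ
  a n = S (G n)
  b n = S (G n ⊕ tail-sum n (suc d))

  partialS : (n s c : ℕ) → ℤ
  partialS n s c = S (G n ⊕ suffixSum s c)

  G-∷ʳ : ∀ {n} → d ≤ n → ∀ (w : Vec Bool n) x → G (suc n) (w ∷ʳ x) ≡ G n w xor (x ∧ suffixMonomial d w)
  G-∷ʳ {n} d≤n w x = begin
    τ (suc n) (suc d) (w ∷ʳ x) xor lift j F (w ∷ʳ x)
      ≡⟨ cong₂ _xor_ (τ-∷ʳ d d≤n w x) (lift-∷ʳ j F (ℕ.≤-trans j≤d d≤n) w x) ⟩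
    (τ n (suc d) w xor m) xor lift j F w   ≡⟨ xor-assoc (τ n (suc d) w) m _ ⟩
    τ n (suc d) w xor (m xor lift j F w)   ≡⟨ cong (τ n (suc d) w xor_) (xor-comm m _) ⟩
    τ n (suc d) w xor (lift j F w xor m)   ≡⟨ xor-assoc (τ n (suc d) w) _ m ⟨
    G n w xor m                            ∎
    where
    m = x ∧ suffixMonomial d w

  partialS-step : ∀ n s c → d ≤ n → s +ℕ c ≡ d → partialS (suc n) (suc s) c ≡ a n + partialS n s (suc c)
  partialS-step n s c d≤n s+c≡d = S-extend {G = G (suc n) ⊕ suffixSum (suc s) c} (G n) (suffixSum s (suc c)) extend
    where
    merge : ∀ g m σ x → (g xor (x ∧ m)) xor (x ∧ σ) ≡ g xor (x ∧ (σ xor m))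
    merge g m σ false = xor-identityʳ (g xor false)
    merge g m σ true  = trans (xor-assoc g m σ) (cong (g xor_) (xor-comm m σ))
    extend : ∀ w x → (G (suc n) ⊕ suffixSum (suc s) c) (w ∷ʳ x) ≡ G n w xor (x ∧ suffixSum s (suc c) w)
    extend w x = begin
      G (suc n) (w ∷ʳ x) xor suffixSum (suc s) c (w ∷ʳ x)
        ≡⟨ cong₂ _xor_ (G-∷ʳ d≤n w x) (suffixSum-∷ʳ w x s c) ⟩
      (G n w xor (x ∧ suffixMonomial d w)) xor (x ∧ suffixSum s c w)
        ≡⟨ merge (G n w) _ _ x ⟩
      G n w xor (x ∧ (suffixSum s c w xor suffixMonomial d w))
        ≡⟨ cong (λ e → G n w xor (x ∧ (suffixSum s c w xor suffixMonomial e w))) s+c≡d ⟨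
      G n w xor (x ∧ (suffixSum s c w xor suffixMonomial (s +ℕ c) w))
        ≡⟨ cong (λ σ → G n w xor (x ∧ σ)) (⊕-∷ʳ s c (λ u → suffixMonomial u w)) ⟨
      G n w xor (x ∧ suffixSum s (suc c) w) ∎

  -- suffixMonomial 0 = true, so partialS n 0 (suc d) is the character sum of not ∘ (G n ⊕ tail-sum n (suc d)).
  b-step : ∀ n → d ≤ n → b (suc n) ≡ a n - b n
  b-step n d≤n = begin
    partialS (suc n) 1 d                       ≡⟨ partialS-step n 0 d d≤n refl ⟩
    a n + partialS n 0 (suc d)                 ≡⟨ cong (_+_ (a n)) (S-cong (λ w → not-distribʳ-xor (G n w) _)) ⟨
    a n + S (not ∘ (G n ⊕ tail-sum n (suc d))) ≡⟨ cong (_+_ (a n)) (S-not (G n ⊕ tail-sum n (suc d))) ⟩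
    a n - b n                                  ∎

  partialS-unfold : ∀ i c n → i +ℕ d ≤ n → i +ℕ c ≡ d →
                    partialS n (suc i) c ≡ Σ₁ i (λ t → a (n ∸ t)) + b (n ∸ i)
  partialS-unfold zero    c n       _         refl = sym (ℤ.+-identityˡ (b n))
  partialS-unfold (suc i) c (suc n) (s≤s i+d≤n) i+c≡d = begin
    partialS (suc n) (suc (suc i)) c                       ≡⟨ partialS-step n (suc i) c d≤n i+c≡d ⟩
    a n + partialS n (suc i) (suc c)                       ≡⟨ cong (_+_ (a n)) (partialS-unfold i (suc c) n i+d≤n
                                                                   (trans (ℕ.+-suc i c) i+c≡d)) ⟩
    a n + (Σ₁ i (λ t → a (n ∸ t)) + b (n ∸ i))             ≡⟨ ℤ.+-assoc (a n) _ _ ⟨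
    (a n + Σ₁ i (λ t → a (n ∸ t))) + b (n ∸ i)             ≡⟨ cong (_+ b (n ∸ i)) (Σ₁-peel i (λ t → a (suc n ∸ t))) ⟨
    Σ₁ (suc i) (λ t → a (suc n ∸ t)) + b (n ∸ i)           ∎
    where
    d≤n : d ≤ n
    d≤n = ℕ.≤-trans (ℕ.m≤n+m d i) i+d≤n

  a-window : ∀ n → d +ℕ d ≤ n → a n ≡ Σ₁ d (λ t → a (n ∸ t)) + b (n ∸ d)
  a-window n d+d≤n = begin
    a n                                ≡⟨ S-cong (λ w → xor-identityʳ (G n w)) ⟨
    partialS n (suc d) 0               ≡⟨ partialS-unfold d 0 n d+d≤n (ℕ.+-identityʳ d) ⟩
    Σ₁ d (λ t → a (n ∸ t)) + b (n ∸ d) ∎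

TwiceSumRecurrence : ℕ → ℕ → (ℕ → ℤ) → Set
TwiceSumRecurrence d n₀ a = ∀ n → n₀ ≤ n → a (suc n) ≡ + 2 * Σ₁ d (λ i → a (n ∸ i))

module Elimination (d : ℕ) (a b : ℕ → ℤ)
  (b-step : ∀ n → d ≤ n → b (suc n) ≡ a n - b n)
  (a-window : ∀ n → d +ℕ d ≤ n → a n ≡ Σ₁ d (λ t → a (n ∸ t)) + b (n ∸ d)) where

  a-split : ∀ n → d ≤ n → a n ≡ b (suc n) + b n
  a-split n d≤n = trans (x≡x-y+y (a n) (b n)) (cong (_+ b n) (sym (b-step n d≤n)))
    where
    x≡x-y+y : ∀ x y → x ≡ (x - y) + y
    x≡x-y+y = solve-∀

  Σa-split : ∀ n → d +ℕ d ≤ n →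
             Σ₁ d (λ t → a (n ∸ t)) ≡ Σ₁ d (λ t → b (suc n ∸ t)) + Σ₁ d (λ t → b (n ∸ t))
  Σa-split n d+d≤n = trans (Σ₁-cong d split-term) (Σ₁-+ d _ _)
    where
    split-term : ∀ t → 1 ≤ t → t ≤ d → a (n ∸ t) ≡ b (suc n ∸ t) + b (n ∸ t)
    split-term t _ t≤d = begin
      a (n ∸ t)                   ≡⟨ a-split (n ∸ t) (ℕ.m+n≤o⇒m≤o∸n d (ℕ.≤-trans (ℕ.+-monoʳ-≤ d t≤d) d+d≤n)) ⟩
      b (suc (n ∸ t)) + b (n ∸ t) ≡⟨ cong (λ m → b m + b (n ∸ t)) (ℕ.+-∸-assoc 1 t≤n) ⟨
      b (suc n ∸ t) + b (n ∸ t)   ∎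
      where
      t≤n : t ≤ n
      t≤n = ℕ.≤-trans t≤d (ℕ.m+n≤o⇒m≤o d d+d≤n)

  b-recurrence : TwiceSumRecurrence d (d +ℕ d) b
  b-recurrence n d+d≤n = begin
    b (suc n)                                ≡⟨ b-step n (ℕ.m+n≤o⇒m≤o d d+d≤n) ⟩
    a n - b n                                ≡⟨ cong (_- b n) (a-window n d+d≤n) ⟩
    (Σ₁ d (λ t → a (n ∸ t)) + b (n ∸ d)) - b n ≡⟨ cong (λ σ → (σ + b (n ∸ d)) - b n) (Σa-split n d+d≤n) ⟩
    ((σ⁺ + σ) + b (n ∸ d)) - b n             ≡⟨ rearrange σ⁺ σ (b (n ∸ d)) (b n) ⟩
    ((σ⁺ + b (n ∸ d)) + σ) - b n             ≡⟨ cong (λ e → (e + σ) - b n) (Σ₁-telescope d n b) ⟩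
    ((b n + σ) + σ) - b n                    ≡⟨ cancel (b n) σ ⟩
    + 2 * σ                                  ∎
    where
    σ⁺ = Σ₁ d (λ t → b (suc n ∸ t))
    σ  = Σ₁ d (λ t → b (n ∸ t))
    rearrange : ∀ x y z w → ((x + y) + z) - w ≡ ((x + z) + y) - w
    rearrange = solve-∀
    cancel : ∀ x y → ((x + y) + y) - x ≡ + 2 * y
    cancel = solve-∀

  a-recurrence : TwiceSumRecurrence d (d +ℕ d) a
  a-recurrence n d+d≤n = begin
    a (suc n)                                      ≡⟨ a-split (suc n) (ℕ.≤-trans (ℕ.m+n≤o⇒m≤o d d+d≤n) (ℕ.n≤1+n n)) ⟩
    b (suc (suc n)) + b (suc n)                    ≡⟨ cong₂ _+_ (b-recurrence (suc n) (ℕ.m≤n⇒m≤1+n d+d≤n)) (b-recurrence n d+d≤n) ⟩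
    + 2 * Σ₁ d (λ t → b (suc n ∸ t)) + + 2 * Σ₁ d (λ t → b (n ∸ t))
                                                   ≡⟨ ℤ.*-distribˡ-+ (+ 2) (Σ₁ d (λ t → b (suc n ∸ t))) (Σ₁ d (λ t → b (n ∸ t))) ⟨
    + 2 * (Σ₁ d (λ t → b (suc n ∸ t)) + Σ₁ d (λ t → b (n ∸ t)))
                                                   ≡⟨ cong (+ 2 *_) (Σa-split n d+d≤n) ⟨
    + 2 * Σ₁ d (λ t → a (n ∸ t))                   ∎

p-coeff-last : ∀ d → - MonicPoly.coeff (p (suc d)) d ≡ + 0
p-coeff-last zero    = refl
p-coeff-last (suc d) = p-coeff-last d

p-coeff-inner : ∀ {d} i → i < d → - MonicPoly.coeff (p (suc d)) (d ∸ suc i) ≡ + 2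
p-coeff-inner {suc d} i _ with d ∸ i <ᵇ suc d | ℕ.<⇒<ᵇ (s≤s (ℕ.m∸n≤m d i))
... | true | _ = refl

twiceSum⇒p-recurrence : ∀ d a → TwiceSumRecurrence d (d +ℕ d) a → SatisfiesRecurrence (p (suc d)) (suc d) a
twiceSum⇒p-recurrence d a rec zero    ()
twiceSum⇒p-recurrence d a rec (suc n) (s≤s 2k≤n+1) = begin
  a (suc n)                             ≡⟨ rec n (ℕ.≤-trans (ℕ.+-monoʳ-≤ d (ℕ.n≤1+n d)) 2k≤n+1) ⟩
  + 2 * Σ₁ d (λ i → a (n ∸ i))          ≡⟨ Σ₁-*ˡ d (+ 2) (λ i → a (n ∸ i)) ⟨
  Σ₁ d (λ i → + 2 * a (n ∸ i))          ≡⟨ Σ₁-cong d inner ⟩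
  Σ₁ d (λ i → c (suc i) * a (n ∸ i))    ≡⟨ ℤ.+-identityˡ _ ⟨
  + 0 + Σ₁ d (λ i → c (suc i) * a (n ∸ i)) ≡⟨ cong (_+ Σ₁ d (λ i → c (suc i) * a (n ∸ i))) (ℤ.*-zeroˡ (a n)) ⟨
  + 0 * a n + Σ₁ d (λ i → c (suc i) * a (n ∸ i))
                                        ≡⟨ cong (λ z → z * a n + Σ₁ d (λ i → c (suc i) * a (n ∸ i))) (p-coeff-last d) ⟨
  c 1 * a n + Σ₁ d (λ i → c (suc i) * a (n ∸ i)) ≡⟨ Σ₁-peel d (λ i → c i * a (suc n ∸ i)) ⟨
  Σ₁ (suc d) (λ i → c i * a (suc n ∸ i)) ∎
  where
  c : ℕ → ℤ
  c i = - MonicPoly.coeff (p (suc d)) (suc d ∸ i)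
  inner : ∀ i → 1 ≤ i → i ≤ d → + 2 * a (n ∸ i) ≡ c (suc i) * a (n ∸ i)
  inner (suc i) _ i<d = cong (_* a (n ∸ suc i)) (sym (p-coeff-inner i i<d))

lemma2p2 : (k j : ℕ) → 2 ≤ k → 1 ≤ j → j < k → (F : BoolFun j) →
    SatisfiesRecurrence (p k) k (λ n → S (τ n k ⊕ lift j F))
    × SatisfiesRecurrence (p k) k (λ n → S ((τ n k ⊕ lift j F) ⊕ tail-sum n k))
lemma2p2 (suc d) j _ _ (s≤s j≤d) F =
  twiceSum⇒p-recurrence d a a-recurrence , twiceSum⇒p-recurrence d b b-recurrence
  where
  open Splitting d j j≤d F
  open Elimination d a b b-step a-window
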